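{- Let $\preceq$ be an entrenchment relation. Then its maxiconsistent inference $\mathrel{|\!\sim_\preceq}$ is a nonmonotonic consequence relation. Moreover: (1) if $\preceq$ satisfies Bounded Cut and Bounded Right Monotonicity then $\mathrel{|\!\sim_\preceq}$ is cumulative; (2) if $\preceq$ satisfies Bounded Cut and Right Monotonicity then $\mathrel{|\!\sim_\preceq}$ is strongly cumulative; (3) if $\preceq$ satisfies Transitivity and Right Conjunction then $\mathrel{|\!\sim_\preceq}$ is preferential.
   Context: $\mathcal{L}$ is the set of formulas of a propositional language closed under $\lor,\land,\neg,\to$. $\vdash\subseteq 2^{\mathcal{L}}\times\mathcal{L}$ is a fixed consequence relation including classical propositional logic, compact, satisfying the deduction theorem and disjunction in premises; $\alpha\vdash\beta$ means $\{\alpha\}\vdash\beta$; $\mathrm{Cn}(X)=\{\beta:X\vdash\beta\}$, $\mathrm{Cn}(X,\alpha)=\mathrm{Cn}(X\cup\{\alpha\})$. An entrenchment relation is a binary relation $\preceq$ on $\mathcal{L}$ such that for all $\alpha,\beta,\gamma$: $\alpha\preceq\alpha$; $\alpha\vdash\beta$ and $\beta\preceq\gamma$ imply $\alpha\preceq\gamma$; if $\alpha\vdash\beta$ and $\beta\vdash\alpha$ then $\gamma\preceq\alpha$ iff $\gamma\preceq\beta$. Properties of $\preceq$ (for all formulas): Bounded Cut: $\gamma\preceq\alpha\lor\beta$ and $\beta\preceq\alpha$ imply $\gamma\preceq\alpha$. Bounded Right Monotonicity: $\gamma\preceq\alpha$ and $\beta\preceq\alpha$ imply $\gamma\preceq\alpha\lor\beta$.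 Right Monotonicity: $\alpha\preceq\beta$ and $\beta\vdash\gamma$ imply $\alpha\preceq\gamma$. Transitivity: $\alpha\preceq\beta$, $\beta\preceq\gamma$ imply $\alpha\preceq\gamma$. Right Conjunction: $\gamma\preceq\alpha$, $\gamma\preceq\beta$ imply $\gamma\preceq\alpha\land\beta$. Maxiconsistent inference: $\mathrm{Coh}(\alpha)=\{\beta:\beta\not\preceq\neg\alpha\}$; $\mathcal{B}(\alpha)$ = deductively closed $U$ with $U\subseteq\mathrm{Coh}(\alpha)$; $\mathcal{B}_{\max}(\alpha)$ = those $U\in\mathcal{B}(\alpha)$ with no deductively closed $U'\supsetneq U$ in $\mathcal{B}(\alpha)$; $E(\alpha)=\bigcap\{\mathrm{Cn}(U,\alpha):U\in\mathcal{B}_{\max}(\alpha)\}$ (empty intersection $=\mathcal{L}$); $\alpha\mathrel{|\!\sim_\preceq}\beta$ iff $\beta\in E(\alpha)$. A nonmonotonic consequence relation is a binary relation $\mathrel{|\!\sim}$ on $\mathcal{L}$ satisfying, for all formulas: Supraclassicality ($\alpha\vdash\beta$ implies $\alpha\mathrel{|\!\sim}\beta$); Left Logical Equivalence (if $\alpha\vdash\beta$, $\beta\vdash\alpha$ and $\alpha\mathrel{|\!\sim}\gamma$ then $\beta\mathrel{|\!\sim}\gamma$); Right Weakening ($\alpha\mathrel{|\!\sim}\beta$ and $\beta\vdash\gamma$ imply $\alpha\mathrel{|\!\sim}\gamma$); And ($\alpha\mathrel{|\!\sim}\beta$, $\alpha\mathrel{|\!\sim}\gamma$ imply $\alpha\mathrel{|\!\sim}\beta\land\gamma$).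 It is cumulative if also Cut ($\alpha\mathrel{|\!\sim}\beta$ and $\alpha\land\beta\mathrel{|\!\sim}\gamma$ imply $\alpha\mathrel{|\!\sim}\gamma$) and Cautious Monotonicity ($\alpha\mathrel{|\!\sim}\beta$ and $\alpha\mathrel{|\!\sim}\gamma$ imply $\alpha\land\beta\mathrel{|\!\sim}\gamma$) hold; strongly cumulative if cumulative and Loop holds (for all $n\ge1$: $\alpha_0\mathrel{|\!\sim}\alpha_1,\dots,\alpha_{n-1}\mathrel{|\!\sim}\alpha_n$ and $\alpha_n\mathrel{|\!\sim}\alpha_0$ imply $\alpha_0\mathrel{|\!\sim}\alpha_n$); preferential if cumulative and Or holds ($\alpha\mathrel{|\!\sim}\gamma$ and $\beta\mathrel{|\!\sim}\gamma$ imply $\alpha\lor\beta\mathrel{|\!\sim}\gamma$). -}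

module Defs where

open import Level using (0ℓ) renaming (suc to lsuc)
open import Data.Bool using (Bool; true; false; _∧_; _∨_; not)
open import Data.Nat using (ℕ; suc; _<_; _≤_)
open import Data.Product using (Σ; ∃; ∃-syntax; _×_; _,_)
open import Data.Sum using (_⊎_)
open import Data.List using (List)
open import Data.List.Relation.Unary.All using (All)
open import Data.List.Membership.Propositional using (_∈_)
open import Relation.Nullary using (¬_)
open import Relation.Unary using (Pred; _⊆_)
open import Relation.Binary.PropositionalEquality using (_≡_)

infixr 6 _∧ᶠ_
infixr 5 _∨ᶠ_
infixr 4 _⇒ᶠ_
infix  7 ¬ᶠ_

data Form (A : Set) : Set where
  atom  : A → Form A
  _∨ᶠ_  : Form A → Form A → Form A
  _∧ᶠ_  : Form A → Form A → Form A
  ¬ᶠ_   : Form A → Form A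
  _⇒ᶠ_  : Form A → Form A → Form A

-- classical two-valued semantics (used to say "⊢ includes classical
-- propositional logic")
eval : {A : Set} → (A → Bool) → Form A → Bool
eval v (atom a) = v a
eval v (φ ∨ᶠ ψ) = eval v φ ∨ eval v ψ
eval v (φ ∧ᶠ ψ) = eval v φ ∧ eval v ψ
eval v (¬ᶠ φ)   = not (eval v φ)
eval v (φ ⇒ᶠ ψ) = not (eval v φ) ∨ eval v ψ

Tautology : {A : Set} → Form A → Set
Tautology {A} φ = (v : A → Bool) → eval v φ ≡ true

FSet : Set → Set₁
FSet A = Pred (Form A) 0ℓ

_⨾_ : {A : Set} → FSet A → Form A → FSet A
(X ⨾ α) β = X β ⊎ β ≡ α

⟦_⟧ : {A : Set} → Form A → FSet A
⟦ α ⟧ β = β ≡ α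

listSet : {A : Set} → List (Form A) → FSet A
listSet Γ β = β ∈ Γ

record ConsRel (A : Set) : Set₁ where
  infix 3 _⊢_
  field
    _⊢_           : FSet A → Form A → Set
    reflexive     : ∀ {X α} → X α → X ⊢ α
    monotone      : ∀ {X Y α} → X ⊆ Y → X ⊢ α → Y ⊢ α
    cut           : ∀ {X Y : FSet A} {α} → (∀ {β} → Y β → X ⊢ β) →
                    (λ γ → X γ ⊎ Y γ) ⊢ α → X ⊢ α
    classical     : ∀ {X α} → Tautology α → X ⊢ α
    compact       : ∀ {X α} → X ⊢ α →
                    ∃[ Γ ] (All X Γ × listSet Γ ⊢ α)
    deduction     : ∀ {X α β} → (X ⨾ α) ⊢ β → X ⊢ (α ⇒ᶠ β)
    deduction⁻¹   : ∀ {X α β} → X ⊢ (α ⇒ᶠ β) → (X ⨾ α) ⊢ β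
    disjPremises  : ∀ {X α β γ} → (X ⨾ α) ⊢ γ → (X ⨾ β) ⊢ γ →
                    (X ⨾ (α ∨ᶠ β)) ⊢ γ

module _ {A : Set} (C : ConsRel A) where
  open ConsRel C

  _⊢₁_ : Form A → Form A → Set
  α ⊢₁ β = ⟦ α ⟧ ⊢ β

  Cn : FSet A → FSet A
  Cn X β = X ⊢ β

  Cn+ : FSet A → Form A → FSet A
  Cn+ X α = Cn (X ⨾ α)

  DedClosed : FSet A → Set
  DedClosed U = Cn U ⊆ U

record Entrenchment {A : Set} (C : ConsRel A) : Set₁ where
  infix 4 _≼_
  field
    _≼_     : Form A → Form A → Set
    ≼-refl  : ∀ {α} → α ≼ α
    ≼-left  : ∀ {α β γ} → _⊢₁_ C α β → β ≼ γ → α ≼ γ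
    ≼-equiv : ∀ {α β γ} → _⊢₁_ C α β → _⊢₁_ C β α → (γ ≼ α → γ ≼ β) × (γ ≼ β → γ ≼ α)

module _ {A : Set} {C : ConsRel A} (E : Entrenchment C) where
  open Entrenchment E

  BoundedCut : Set
  BoundedCut = ∀ {α β γ} → γ ≼ (α ∨ᶠ β) → β ≼ α → γ ≼ α

  BoundedRightMonotonicity : Set
  BoundedRightMonotonicity = ∀ {α β γ} → γ ≼ α → β ≼ α → γ ≼ (α ∨ᶠ β)

  RightMonotonicity : Set
  RightMonotonicity = ∀ {α β γ} → α ≼ β → _⊢₁_ C β γ → α ≼ γ

  Transitivity : Set
  Transitivity = ∀ {α β γ} → α ≼ β → β ≼ γ → α ≼ γ

  RightConjunction : Set
  RightConjunction = ∀ {α β γ} → γ ≼ α → γ ≼ β → γ ≼ (α ∧ᶠ β)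

  Coh : Form A → FSet A
  Coh α β = ¬ (β ≼ ¬ᶠ α)

  ℬ : Form A → Pred (FSet A) 0ℓ
  ℬ α U = DedClosed C U × U ⊆ Coh α

  ℬmax : Form A → Pred (FSet A) (lsuc 0ℓ)
  ℬmax α U = ℬ α U × (∀ U' → ℬ α U' → U ⊆ U' → U' ⊆ U)

  -- E(α) = ⋂ { Cn(U, α) : U ∈ ℬmax(α) }   (empty intersection = L)
  Ext : Form A → Pred (Form A) (lsuc 0ℓ)
  Ext α β = ∀ U → ℬmax α U → Cn+ C U α β

  infix 3 _|∼_
  _|∼_ : Form A → Form A → Set₁
  α |∼ β = Ext α β

module _ {A : Set} (C : ConsRel A) {ℓ} (_|~_ : Form A → Form A → Set ℓ) where

  Supraclassicality : Set ℓ
  Supraclassicality = ∀ {α β} → _⊢₁_ C α β → α |~ β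

  LeftLogicalEquivalence : Set ℓ
  LeftLogicalEquivalence = ∀ {α β γ} → _⊢₁_ C α β → _⊢₁_ C β α → α |~ γ → β |~ γ

  RightWeakening : Set ℓ
  RightWeakening = ∀ {α β γ} → α |~ β → _⊢₁_ C β γ → α |~ γ

  AndRule : Set ℓ
  AndRule = ∀ {α β γ} → α |~ β → α |~ γ → α |~ (β ∧ᶠ γ)

  CutRule : Set ℓ
  CutRule = ∀ {α β γ} → α |~ β → (α ∧ᶠ β) |~ γ → α |~ γ

  CautiousMonotonicity : Set ℓ
  CautiousMonotonicity = ∀ {α β γ} → α |~ β → α |~ γ → (α ∧ᶠ β) |~ γ

  Loop : Set ℓ
  Loop = ∀ (n : ℕ) (α : ℕ → Form A) → 1 ≤ n →
         (∀ i → i < n → α i |~ α (suc i)) → α n |~ α 0 → α 0 |~ α n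

  OrRule : Set ℓ
  OrRule = ∀ {α β γ} → α |~ γ → β |~ γ → (α ∨ᶠ β) |~ γ

  NonmonotonicConsequence : Set ℓ
  NonmonotonicConsequence =
    Supraclassicality × LeftLogicalEquivalence × RightWeakening × AndRule

  Cumulative : Set ℓ
  Cumulative = NonmonotonicConsequence × CutRule × CautiousMonotonicity

  StronglyCumulative : Set ℓ
  StronglyCumulative = Cumulative × Loop

  Preferential : Set ℓ
  Preferential = Cumulative × OrRule

-- Classical metatheory (the paper works in ordinary set theory).

IsChain : {X : Set} → Pred (Pred X 0ℓ) 0ℓ → {I : Set} → (I → Pred X 0ℓ) → Set
IsChain P {I} c = (∀ i → P (c i)) × (∀ i j → c i ⊆ c j ⊎ c j ⊆ c i)

ZornLemma : Set₁
ZornLemma = ∀ {X : Set} (P : Pred (Pred X 0ℓ) 0ℓ) →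
  (∀ {I : Set} (c : I → Pred X 0ℓ) → IsChain P c →
     ∃[ U ] (P U × (∀ i → c i ⊆ U))) →
  ∃[ M ] (P M × (∀ U → P U → M ⊆ U → U ⊆ M))

{-# OPTIONS --safe #-}
-- Every α-coherent theory extends, by Zorn's lemma, to a maximal one, and
-- α |∼ β forces α ∧ ¬β ≼ ¬α: otherwise Cn(α ∧ ¬β) is α-coherent, and a maximal
-- extension of it would derive β, hence ¬α.  Cut and Cautious Monotonicity hold
-- once ℬmax(α) = ℬmax(α ∧ β) whenever α |∼ β.  Under Bounded Cut and Bounded
-- Right Monotonicity this follows from Coh(α ∧ β) = Coh(α), which the inequality
-- gives since ¬(α ∧ β) is equivalent to ¬α ∨ (α ∧ ¬β).  Under Bounded Cut and
-- Right Monotonicity, Coh grows along |∼, so it is constant around a loop.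
-- Under Transitivity and Right Conjunction, maximal sets are upward closed
-- under ≼, so a set maximal for α ∨ β either contains ¬α or is maximal for α,
-- which gives Or.

module Submission where

open import Defs
open import Level using (0ℓ; Lift; lift; lower) renaming (suc to lsuc)
open import Function using (id)
open import Function.Bundles using (Equivalence)
open import Data.Bool using (Bool; true; false; T; not; _∧_; _∨_)
open import Data.Bool.Properties using (T-≡)
open import Data.Product using (_×_; _,_; proj₁; proj₂; ∃-syntax; swap)
open import Data.Sum using (_⊎_; inj₁; inj₂)
open import Data.Maybe using (Maybe; nothing; just)
open import Data.Nat using (zero; suc; _≤_; _≤′_; ≤′-refl; ≤′-step)
open import Data.Nat.Properties using (≤-refl; <⇒≤; z≤′n; ≤⇒≤′)
open import Data.List.Relation.Unary.All using (All; []; _∷_)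
open import Data.List.Relation.Unary.Any using (here; there)
open import Data.List.Membership.Propositional using (_∈_)
open import Relation.Nullary using (¬_; yes; no)
open import Relation.Nullary.Decidable using (map′)
open import Relation.Unary using (Pred; _⊆_; _≐_; ⋃)
open import Relation.Binary.PropositionalEquality using (_≡_; refl; cong; cong₂; trans)
open import Axiom.ExcludedMiddle using (ExcludedMiddle)
open import Axiom.DoubleNegationElimination using (em⇒dne)

lowerExcludedMiddle : ∀ {ℓ} → ExcludedMiddle (lsuc ℓ) → ExcludedMiddle ℓ
lowerExcludedMiddle em = map′ lower lift em

finite⊆chain : {X I : Set} {c : I → Pred X 0ℓ} → I → (∀ i j → c i ⊆ c j ⊎ c j ⊆ c i) →
               ∀ {xs} → All (⋃ I c) xs → ∃[ i ] (λ x → x ∈ xs) ⊆ c i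
finite⊆chain i₀ comparable [] = i₀ , λ ()
finite⊆chain i₀ comparable ((j , x∈cⱼ) ∷ xs⊆⋃) with finite⊆chain i₀ comparable xs⊆⋃
... | i , xs⊆cᵢ with comparable i j
...   | inj₁ cᵢ⊆cⱼ = j , λ { (here refl) → x∈cⱼ ; (there x∈xs) → cᵢ⊆cⱼ (xs⊆cᵢ x∈xs) }
...   | inj₂ cⱼ⊆cᵢ = i , λ { (here refl) → cⱼ⊆cᵢ x∈cⱼ ; (there x∈xs) → xs⊆cᵢ x∈xs }

infixl 8 _⟨_⟩

_⟨_⟩ : {A B : Set} → Form B → (B → Form A) → Form A
atom x   ⟨ σ ⟩ = σ x
(φ ∨ᶠ ψ) ⟨ σ ⟩ = φ ⟨ σ ⟩ ∨ᶠ ψ ⟨ σ ⟩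
(φ ∧ᶠ ψ) ⟨ σ ⟩ = φ ⟨ σ ⟩ ∧ᶠ ψ ⟨ σ ⟩
(¬ᶠ φ)   ⟨ σ ⟩ = ¬ᶠ φ ⟨ σ ⟩
(φ ⇒ᶠ ψ) ⟨ σ ⟩ = φ ⟨ σ ⟩ ⇒ᶠ ψ ⟨ σ ⟩

eval-⟨⟩ : {A B : Set} {v : A → Bool} {w : B → Bool} (σ : B → Form A) →
          (∀ x → eval v (σ x) ≡ w x) → ∀ φ → eval v (φ ⟨ σ ⟩) ≡ eval w φ
eval-⟨⟩ σ vσ≗w (atom x) = vσ≗w x
eval-⟨⟩ σ vσ≗w (φ ∨ᶠ ψ) = cong₂ _∨_ (eval-⟨⟩ σ vσ≗w φ) (eval-⟨⟩ σ vσ≗w ψ)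
eval-⟨⟩ σ vσ≗w (φ ∧ᶠ ψ) = cong₂ _∧_ (eval-⟨⟩ σ vσ≗w φ) (eval-⟨⟩ σ vσ≗w ψ)
eval-⟨⟩ σ vσ≗w (¬ᶠ φ)   = cong not (eval-⟨⟩ σ vσ≗w φ)
eval-⟨⟩ σ vσ≗w (φ ⇒ᶠ ψ) = cong₂ (λ x y → not x ∨ y) (eval-⟨⟩ σ vσ≗w φ) (eval-⟨⟩ σ vσ≗w ψ)

assign : {X : Set} → X → X → Bool → X
assign x y true  = x
assign x y false = y

P Q : Form Bool
P = atom true
Q = atom false

-- For a closed φ this computes to a product of unit types, so the implicit
-- argument of tautology₂ is found by unification.
TruthTable₂ : Form Bool → Set
TruthTable₂ φ = T (eval (assign true true) φ) × T (eval (assign true false) φ)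
              × T (eval (assign false true) φ) × T (eval (assign false false) φ)

truthTable₂-row : ∀ {φ} → TruthTable₂ φ → ∀ x y → T (eval (assign x y) φ)
truthTable₂-row (tt , _  , _  , _ ) true  true  = tt
truthTable₂-row (_  , tf , _  , _ ) true  false = tf
truthTable₂-row (_  , _  , ft , _ ) false true  = ft
truthTable₂-row (_  , _  , _  , ff) false false = ff

tautology₂ : {A : Set} (φ : Form Bool) → {TruthTable₂ φ} →
             (a b : Form A) → Tautology (φ ⟨ assign a b ⟩)
tautology₂ φ {table} a b v =
  trans (eval-⟨⟩ {w = assign (eval v a) (eval v b)} (assign a b)
                 (λ { true → refl ; false → refl }) φ)
        (Equivalence.to T-≡ (truthTable₂-row {φ} table (eval v a) (eval v b)))

module _ {A : Set} (a b : Form A) where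

  ∧-intro : Tautology (a ⇒ᶠ b ⇒ᶠ a ∧ᶠ b)
  ∧-intro = tautology₂ (P ⇒ᶠ Q ⇒ᶠ P ∧ᶠ Q) a b

  ∧-elimˡ : Tautology (a ∧ᶠ b ⇒ᶠ a)
  ∧-elimˡ = tautology₂ (P ∧ᶠ Q ⇒ᶠ P) a b

  ∧-elimʳ : Tautology (a ∧ᶠ b ⇒ᶠ b)
  ∧-elimʳ = tautology₂ (P ∧ᶠ Q ⇒ᶠ Q) a b

  ∨-introˡ : Tautology (a ⇒ᶠ a ∨ᶠ b)
  ∨-introˡ = tautology₂ (P ⇒ᶠ P ∨ᶠ Q) a b

  ∨-introʳ : Tautology (b ⇒ᶠ a ∨ᶠ b)
  ∨-introʳ = tautology₂ (Q ⇒ᶠ P ∨ᶠ Q) a b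

  explosion : Tautology (a ⇒ᶠ ¬ᶠ a ⇒ᶠ b)
  explosion = tautology₂ (P ⇒ᶠ ¬ᶠ P ⇒ᶠ Q) a b

  contraposition : Tautology ((a ⇒ᶠ b) ⇒ᶠ ¬ᶠ b ⇒ᶠ ¬ᶠ a)
  contraposition = tautology₂ ((P ⇒ᶠ Q) ⇒ᶠ ¬ᶠ Q ⇒ᶠ ¬ᶠ P) a b

  ¬∧→¬∨∧¬ : Tautology (¬ᶠ (a ∧ᶠ b) ⇒ᶠ ¬ᶠ a ∨ᶠ a ∧ᶠ ¬ᶠ b)
  ¬∧→¬∨∧¬ = tautology₂ (¬ᶠ (P ∧ᶠ Q) ⇒ᶠ ¬ᶠ P ∨ᶠ P ∧ᶠ ¬ᶠ Q) a b

  ¬∨∧¬→¬∧ : Tautology (¬ᶠ a ∨ᶠ a ∧ᶠ ¬ᶠ b ⇒ᶠ ¬ᶠ (a ∧ᶠ b))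
  ¬∨∧¬→¬∧ = tautology₂ (¬ᶠ P ∨ᶠ P ∧ᶠ ¬ᶠ Q ⇒ᶠ ¬ᶠ (P ∧ᶠ Q)) a b

  ¬∧∧⇒→¬ : Tautology (¬ᶠ (a ∧ᶠ b) ∧ᶠ (a ⇒ᶠ b) ⇒ᶠ ¬ᶠ a)
  ¬∧∧⇒→¬ = tautology₂ (¬ᶠ (P ∧ᶠ Q) ∧ᶠ (P ⇒ᶠ Q) ⇒ᶠ ¬ᶠ P) a b

  ¬→¬∧∧⇒ : Tautology (¬ᶠ a ⇒ᶠ ¬ᶠ (a ∧ᶠ b) ∧ᶠ (a ⇒ᶠ b))
  ¬→¬∧∧⇒ = tautology₂ (¬ᶠ P ⇒ᶠ ¬ᶠ (P ∧ᶠ Q) ∧ᶠ (P ⇒ᶠ Q)) a b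

module Classical {A : Set} (C : ConsRel A) where
  open ConsRel C

  private variable
    X U : FSet A
    a b c : Form A

  infix 3 _⊩_ _⊣⊢_

  _⊩_ : Form A → Form A → Set
  _⊩_ = _⊢₁_ C

  _⊣⊢_ : Form A → Form A → Set
  a ⊣⊢ b = a ⊩ b × b ⊩ a

  ⊢-cut : X ⊢ a → X ⨾ a ⊢ b → X ⊢ b
  ⊢-cut {X} {a} ⊢a = cut {X} {⟦ a ⟧} λ { refl → ⊢a }

  ⊢-mp : X ⊢ a → X ⊢ a ⇒ᶠ b → X ⊢ b
  ⊢-mp ⊢a ⊢a⇒b = ⊢-cut ⊢a (deduction⁻¹ ⊢a⇒b)

  -- Tautology unfolds to a function type over valuations, from which a and b
  -- cannot be inferred; the derived rules below fix them once and for all.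
  ⊢-taut : Tautology (a ⇒ᶠ b) → X ⊢ a → X ⊢ b
  ⊢-taut a⇒b ⊢a = ⊢-mp ⊢a (classical a⇒b)

  ⊢-taut₂ : Tautology (a ⇒ᶠ b ⇒ᶠ c) → X ⊢ a → X ⊢ b → X ⊢ c
  ⊢-taut₂ a⇒b⇒c ⊢a ⊢b = ⊢-mp ⊢b (⊢-taut a⇒b⇒c ⊢a)

  ⊢-∧ : X ⊢ a → X ⊢ b → X ⊢ a ∧ᶠ b
  ⊢-∧ {a = a} {b = b} = ⊢-taut₂ (∧-intro a b)

  ⊢-∧ˡ : X ⊢ a ∧ᶠ b → X ⊢ a
  ⊢-∧ˡ {a = a} {b = b} = ⊢-taut (∧-elimˡ a b)

  ⊢-∧ʳ : X ⊢ a ∧ᶠ b → X ⊢ b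
  ⊢-∧ʳ {a = a} {b = b} = ⊢-taut (∧-elimʳ a b)

  ⊢-explode : X ⊢ a → X ⊢ ¬ᶠ a → X ⊢ b
  ⊢-explode {a = a} {b = b} = ⊢-taut₂ (explosion a b)

  ⊩-∧ˡ : a ∧ᶠ b ⊩ a
  ⊩-∧ˡ = ⊢-∧ˡ (reflexive refl)

  ⊩-∧ʳ : a ∧ᶠ b ⊩ b
  ⊩-∧ʳ = ⊢-∧ʳ (reflexive refl)

  ⊩-∨ˡ : a ⊩ a ∨ᶠ b
  ⊩-∨ˡ {a = a} {b = b} = ⊢-taut (∨-introˡ a b) (reflexive refl)

  ⊩-∨ʳ : b ⊩ a ∨ᶠ b
  ⊩-∨ʳ {b = b} {a = a} = ⊢-taut (∨-introʳ a b) (reflexive refl)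

  ⊢-⊩ : X ⊢ a → a ⊩ b → X ⊢ b
  ⊢-⊩ ⊢a a⊩b = ⊢-cut ⊢a (monotone inj₂ a⊩b)

  ⨾-⊢-trans : X ⨾ a ⊢ b → X ⨾ b ⊢ c → X ⨾ a ⊢ c
  ⨾-⊢-trans ⊢b b⊢c =
    ⊢-cut ⊢b (monotone (λ { (inj₁ x) → inj₁ (inj₁ x) ; (inj₂ refl) → inj₂ refl }) b⊢c)

  ⊩-contrapose : a ⊩ b → ¬ᶠ b ⊩ ¬ᶠ a
  ⊩-contrapose {a = a} {b = b} a⊩b =
    ⊢-taut₂ (contraposition a b) (deduction (monotone inj₂ a⊩b)) (reflexive refl)

  ⊣⊢-contrapose : a ⊣⊢ b → ¬ᶠ a ⊣⊢ ¬ᶠ b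
  ⊣⊢-contrapose (a⊩b , b⊩a) = ⊩-contrapose b⊩a , ⊩-contrapose a⊩b

  ¬∧-⊣⊢ : ¬ᶠ (a ∧ᶠ b) ⊣⊢ ¬ᶠ a ∨ᶠ a ∧ᶠ ¬ᶠ b
  ¬∧-⊣⊢ {a = a} {b = b} =
    ⊢-taut (¬∧→¬∨∧¬ a b) (reflexive refl) , ⊢-taut (¬∨∧¬→¬∧ a b) (reflexive refl)

  ¬∧∧⇒-⊣⊢ : ¬ᶠ (a ∧ᶠ b) ∧ᶠ (a ⇒ᶠ b) ⊣⊢ ¬ᶠ a
  ¬∧∧⇒-⊣⊢ {a = a} {b = b} =
    ⊢-taut (¬∧∧⇒→¬ a b) (reflexive refl) , ⊢-taut (¬→¬∧∧⇒ a b) (reflexive refl)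

  Cn-closed : DedClosed C (Cn C X)
  Cn-closed {X} ⊢Cn = cut {X} {Cn C X} id (monotone inj₂ ⊢Cn)

  closed-⇒ : DedClosed C U → U ⨾ a ⊢ b → U (a ⇒ᶠ b)
  closed-⇒ closed a⊢b = closed (deduction a⊢b)

  closed-∧ : DedClosed C U → U a → U b → U (a ∧ᶠ b)
  closed-∧ closed a∈U b∈U = closed (⊢-∧ (reflexive a∈U) (reflexive b∈U))

module Maxiconsistent {A : Set} {C : ConsRel A} (E : Entrenchment C) where
  open ConsRel C
  open Entrenchment E
  open Classical C

  infix 3 _|∼ᴱ_

  _|∼ᴱ_ : Form A → Form A → Set₁
  _|∼ᴱ_ = _|∼_ E

  private variable
    a b c d d′ x : Form A
    U V M : FSet A

  ≼-respʳ : a ⊣⊢ b → x ≼ a → x ≼ b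
  ≼-respʳ (a⊩b , b⊩a) = proj₁ (≼-equiv a⊩b b⊩a)

  transitivity⇒rightMonotonicity : Transitivity E → RightMonotonicity E
  transitivity⇒rightMonotonicity tr x≼a a⊩b = tr x≼a (≼-left a⊩b ≼-refl)

  rightMonotonicity⇒boundedRightMonotonicity : RightMonotonicity E → BoundedRightMonotonicity E
  rightMonotonicity⇒boundedRightMonotonicity rm x≼a _ = rm x≼a ⊩-∨ˡ

  Coh-antitone : (∀ {x} → x ≼ ¬ᶠ b → x ≼ ¬ᶠ a) → Coh E a ⊆ Coh E b
  Coh-antitone ≼¬b⇒≼¬a x⋠¬a x≼¬b = x⋠¬a (≼¬b⇒≼¬a x≼¬b)

  Coh-resp : a ⊣⊢ b → Coh E a ≐ Coh E b
  Coh-resp {a} {b} a⊣⊢b = Coh-antitone (≼-respʳ (swap ¬a⊣⊢¬b)) , Coh-antitone (≼-respʳ ¬a⊣⊢¬b)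
    where
      ¬a⊣⊢¬b : ¬ᶠ a ⊣⊢ ¬ᶠ b
      ¬a⊣⊢¬b = ⊣⊢-contrapose a⊣⊢b

  Coh-⊩ : RightMonotonicity E → a ⊩ b → Coh E a ⊆ Coh E b
  Coh-⊩ rm a⊩b = Coh-antitone (λ x≼¬b → rm x≼¬b (⊩-contrapose a⊩b))

  Coh-singleton : Coh E a c → ℬ E a (Cn C ⟦ c ⟧)
  Coh-singleton c⋠¬a = Cn-closed , λ c⊩x x≼¬a → c⋠¬a (≼-left c⊩x x≼¬a)

  ℬ-mono : Coh E d ⊆ Coh E d′ → ℬ E d U → ℬ E d′ U
  ℬ-mono Coh⊆Coh′ (closed , U⊆Coh) = closed , λ u → Coh⊆Coh′ (U⊆Coh u)

  ℬmax-restrict : Coh E d′ ⊆ Coh E d → U ⊆ Coh E d′ → ℬmax E d U → ℬmax E d′ U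
  ℬmax-restrict Coh′⊆Coh U⊆Coh′ ((closed , _) , maximal) =
    (closed , U⊆Coh′) , λ U′ U′∈ℬ → maximal U′ (ℬ-mono Coh′⊆Coh U′∈ℬ)

  ℬmax-resp : Coh E d ≐ Coh E d′ → ℬmax E d U → ℬmax E d′ U
  ℬmax-resp (Coh⊆Coh′ , Coh′⊆Coh) U∈ℬmax@((_ , U⊆Coh) , _) =
    ℬmax-restrict Coh′⊆Coh (λ u → Coh⊆Coh′ (U⊆Coh u)) U∈ℬmax

  ℬmax-above : ℬmax E d M → ℬ E d U → M ⊆ U → ℬmax E d U
  ℬmax-above (_ , maximal) U∈ℬ M⊆U =
    U∈ℬ , λ U′ U′∈ℬ U⊆U′ u′ → M⊆U (maximal U′ U′∈ℬ (λ m → U⊆U′ (M⊆U m)) u′)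

  ⋃-chain-ℬ : {I : Set} {c : I → FSet A} → I → IsChain (ℬ E d) c → ℬ E d (Cn C (⋃ I c))
  ⋃-chain-ℬ {d = d} {c = c} i₀ (c∈ℬ , comparable) = Cn-closed , λ ⊢x → coherent (compact ⊢x)
    where
      coherent : ∃[ Γ ] (All (⋃ _ c) Γ × listSet Γ ⊢ x) → Coh E d x
      coherent (Γ , Γ⊆⋃ , Γ⊢x) =
        let i , Γ⊆cᵢ = finite⊆chain i₀ comparable Γ⊆⋃
            cᵢ-closed , cᵢ⊆Coh = c∈ℬ i
        in cᵢ⊆Coh (cᵢ-closed (monotone Γ⊆cᵢ Γ⊢x))

  -- The chain may be empty, so V is adjoined to it as an extra member.
  ℬ-chains-bounded : ℬ E d V → ∀ {I : Set} (c : I → FSet A) →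
                     IsChain (λ U → ℬ E d U × V ⊆ U) c →
                     ∃[ U ] ((ℬ E d U × V ⊆ U) × (∀ i → c i ⊆ U))
  ℬ-chains-bounded {d = d} {V = V} V∈ℬ {I} c (c∈ℬ , comparable) =
    Cn C (⋃ (Maybe I) c⁺) , (⋃-chain-ℬ nothing (c⁺∈ℬ , comparable⁺) , λ v → reflexive (nothing , v)) ,
    λ i x∈cᵢ → reflexive (just i , x∈cᵢ)
    where
      c⁺ : Maybe I → FSet A
      c⁺ nothing  = V
      c⁺ (just i) = c i
      c⁺∈ℬ : ∀ i → ℬ E d (c⁺ i)
      c⁺∈ℬ nothing  = V∈ℬ
      c⁺∈ℬ (just i) = proj₁ (c∈ℬ i)
      comparable⁺ : ∀ i j → c⁺ i ⊆ c⁺ j ⊎ c⁺ j ⊆ c⁺ i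
      comparable⁺ nothing  nothing  = inj₁ id
      comparable⁺ nothing  (just j) = inj₁ (proj₂ (c∈ℬ j))
      comparable⁺ (just i) nothing  = inj₂ (proj₂ (c∈ℬ i))
      comparable⁺ (just i) (just j) = comparable i j

  supraclassicality : Supraclassicality C _|∼ᴱ_
  supraclassicality a⊩b U _ = monotone inj₂ a⊩b

  rightWeakening : RightWeakening C _|∼ᴱ_
  rightWeakening a|∼b b⊩c U U∈ℬmax = ⊢-⊩ (a|∼b U U∈ℬmax) b⊩c

  andRule : AndRule C _|∼ᴱ_
  andRule a|∼b a|∼c U U∈ℬmax = ⊢-∧ (a|∼b U U∈ℬmax) (a|∼c U U∈ℬmax)

  |∼-trans-Coh : Coh E a ≐ Coh E b → a |∼ᴱ b → b |∼ᴱ c → a |∼ᴱ c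
  |∼-trans-Coh Coh≐ a|∼b b|∼c U U∈ℬmax = ⨾-⊢-trans (a|∼b U U∈ℬmax) (b|∼c U (ℬmax-resp Coh≐ U∈ℬmax))

  leftLogicalEquivalence : LeftLogicalEquivalence C _|∼ᴱ_
  leftLogicalEquivalence a⊩b b⊩a = |∼-trans-Coh (Coh-resp (b⊩a , a⊩b)) (supraclassicality b⊩a)

  nonmonotonicConsequence : NonmonotonicConsequence C _|∼ᴱ_
  nonmonotonicConsequence = supraclassicality , leftLogicalEquivalence , rightWeakening , andRule

  module _ (zorn : ZornLemma) where

    ℬmax-extension : ℬ E d V → ∃[ M ] (ℬmax E d M × V ⊆ M)
    ℬmax-extension {d} {V} V∈ℬ =
      let M , (M∈ℬ , V⊆M) , maximal = zorn (λ U → ℬ E d U × V ⊆ U) (ℬ-chains-bounded V∈ℬ)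
      in M , (M∈ℬ , λ U U∈ℬ M⊆U → maximal U (U∈ℬ , λ v → M⊆U (V⊆M v)) M⊆U) , V⊆M

    ℬmax-≐ : Coh E d′ ⊆ Coh E d → (∀ {U} → ℬmax E d U → U ⊆ Coh E d′) → ℬmax E d ≐ ℬmax E d′
    ℬmax-≐ {d′} {d} Coh′⊆Coh ℬmax⊆Coh′ =
      (λ U∈ℬmax → ℬmax-restrict Coh′⊆Coh (ℬmax⊆Coh′ U∈ℬmax) U∈ℬmax) , ℬmax′⊆ℬmax
      where
        ℬmax′⊆ℬmax : ℬmax E d′ ⊆ ℬmax E d
        ℬmax′⊆ℬmax (U∈ℬ′ , maximal′) =
          let U∈ℬ = ℬ-mono Coh′⊆Coh U∈ℬ′
              M , M∈ℬmax@((M-closed , _) , _) , U⊆M = ℬmax-extension U∈ℬ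
          in ℬmax-above M∈ℬmax U∈ℬ (maximal′ _ (M-closed , ℬmax⊆Coh′ M∈ℬmax) U⊆M)

    cumulative-if : (∀ {a b} → a |∼ᴱ b → Coh E (a ∧ᶠ b) ⊆ Coh E a) →
                    (∀ {a b U} → a |∼ᴱ b → ℬmax E a U → U ⊆ Coh E (a ∧ᶠ b)) →
                    Cumulative C _|∼ᴱ_
    cumulative-if Coh∧⊆Coh ℬmax⊆Coh∧ = nonmonotonicConsequence , cutRule , cautiousMonotonicity
      where
        ℬmax-∧ : a |∼ᴱ b → ℬmax E a ≐ ℬmax E (a ∧ᶠ b)
        ℬmax-∧ a|∼b = ℬmax-≐ (Coh∧⊆Coh a|∼b) (ℬmax⊆Coh∧ a|∼b)
        cutRule : CutRule C _|∼ᴱ_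
        cutRule a|∼b a∧b|∼c U U∈ℬmax =
          ⨾-⊢-trans (⊢-∧ (reflexive (inj₂ refl)) (a|∼b U U∈ℬmax)) (a∧b|∼c U (proj₁ (ℬmax-∧ a|∼b) U∈ℬmax))
        cautiousMonotonicity : CautiousMonotonicity C _|∼ᴱ_
        cautiousMonotonicity a|∼b a|∼c U U∈ℬmax =
          ⨾-⊢-trans (monotone inj₂ ⊩-∧ˡ) (a|∼c U (proj₂ (ℬmax-∧ a|∼b) U∈ℬmax))

  module _ (em : ExcludedMiddle 0ℓ) (zorn : ZornLemma) where

    |∼-refutes : a |∼ᴱ b → ℬmax E a U → ¬ (U ⊢ a ∧ᶠ ¬ᶠ b)
    |∼-refutes {b = b} {U = U} a|∼b U∈ℬmax@((closed , U⊆Coh) , _) U⊢a∧¬b =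
      U⊆Coh (closed (⊢-explode U⊢b (⊢-∧ʳ U⊢a∧¬b))) ≼-refl
      where
        U⊢b : U ⊢ b
        U⊢b = ⊢-cut (⊢-∧ˡ U⊢a∧¬b) (a|∼b U U∈ℬmax)

    |∼⇒∧¬≼¬ : a |∼ᴱ b → a ∧ᶠ ¬ᶠ b ≼ ¬ᶠ a
    |∼⇒∧¬≼¬ a|∼b = em⇒dne em λ a∧¬b∈Coh →
      let M , M∈ℬmax , Cn⊆M = ℬmax-extension zorn (Coh-singleton a∧¬b∈Coh)
      in |∼-refutes a|∼b M∈ℬmax (reflexive (Cn⊆M (reflexive refl)))

    Coh-∧-⊆ : BoundedRightMonotonicity E → a |∼ᴱ b → Coh E (a ∧ᶠ b) ⊆ Coh E a
    Coh-∧-⊆ brm a|∼b = Coh-antitone (λ x≼¬a → ≼-respʳ (swap ¬∧-⊣⊢) (brm x≼¬a (|∼⇒∧¬≼¬ a|∼b)))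

    Coh-⊆-∧ : BoundedCut E → a |∼ᴱ b → Coh E a ⊆ Coh E (a ∧ᶠ b)
    Coh-⊆-∧ bc a|∼b = Coh-antitone (λ x≼¬∧ → bc (≼-respʳ ¬∧-⊣⊢ x≼¬∧) (|∼⇒∧¬≼¬ a|∼b))

    cumulative : BoundedCut E → BoundedRightMonotonicity E → Cumulative C _|∼ᴱ_
    cumulative bc brm =
      cumulative-if zorn (Coh-∧-⊆ brm) (λ a|∼b ((_ , U⊆Coh) , _) u → Coh-⊆-∧ bc a|∼b (U⊆Coh u))

    |∼⇒Coh-⊆ : BoundedCut E → RightMonotonicity E → a |∼ᴱ b → Coh E a ⊆ Coh E b
    |∼⇒Coh-⊆ bc rm a|∼b x∈Coh = Coh-⊩ rm ⊩-∧ʳ (Coh-⊆-∧ bc a|∼b x∈Coh)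

    loop : BoundedCut E → RightMonotonicity E → Loop C _|∼ᴱ_
    loop bc rm n α _ step back = α₀|∼ n ≤-refl
      where
        Coh-chain : ∀ {i j} → i ≤′ j → j ≤ n → Coh E (α i) ⊆ Coh E (α j)
        Coh-chain ≤′-refl         _   = id
        Coh-chain (≤′-step i≤′j) j<n =
          λ x∈Coh → |∼⇒Coh-⊆ bc rm (step _ j<n) (Coh-chain i≤′j (<⇒≤ j<n) x∈Coh)
        Coh-α₀ : ∀ {i} → i ≤ n → Coh E (α 0) ≐ Coh E (α i)
        Coh-α₀ i≤n =
          Coh-chain z≤′n i≤n , λ x∈Coh → |∼⇒Coh-⊆ bc rm back (Coh-chain (≤⇒≤′ i≤n) ≤-refl x∈Coh)
        α₀|∼ : ∀ i → i ≤ n → α 0 |∼ᴱ α i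
        α₀|∼ zero    _   = supraclassicality (reflexive refl)
        α₀|∼ (suc i) i<n = |∼-trans-Coh (Coh-α₀ (<⇒≤ i<n)) (α₀|∼ i (<⇒≤ i<n)) (step i i<n)

    stronglyCumulative : BoundedCut E → RightMonotonicity E → StronglyCumulative C _|∼ᴱ_
    stronglyCumulative bc rm = cumulative bc (rightMonotonicity⇒boundedRightMonotonicity rm) , loop bc rm

    module _ (tr : Transitivity E) (rc : RightConjunction E) where

      rm : RightMonotonicity E
      rm = transitivity⇒rightMonotonicity tr

      -- Cn(U, c) stays d-coherent: each of its members z is entailed by y ∧ c,
      -- where y = x ∧ (c ⇒ z) ∈ U and y ≼ y ∧ c.
      ℬmax-upward : ℬmax E d U → U x → x ≼ c → U c
      ℬmax-upward {d} {U} {x} {c} ((closed , U⊆Coh) , maximal) x∈U x≼c =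
        maximal (Cn C (U ⨾ c)) (Cn-closed , Cn⊆Coh) (λ u → reflexive (inj₁ u)) (reflexive (inj₂ refl))
        where
          Cn⊆Coh : Cn C (U ⨾ c) ⊆ Coh E d
          Cn⊆Coh {z} c⊢z z≼¬d = U⊆Coh y∈U (tr y≼y∧c (≼-left y∧c⊩z z≼¬d))
            where
              y : Form A
              y = x ∧ᶠ (c ⇒ᶠ z)
              y∈U : U y
              y∈U = closed-∧ closed x∈U (closed-⇒ closed c⊢z)
              y≼y∧c : y ≼ y ∧ᶠ c
              y≼y∧c = rc ≼-refl (≼-left ⊩-∧ˡ x≼c)
              y∧c⊩z : y ∧ᶠ c ⊩ z
              y∧c⊩z = ⊢-mp (⊢-∧ʳ (reflexive refl)) (⊢-∧ʳ (⊢-∧ˡ (reflexive refl)))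

      ℬmax-stronger : a ⊩ d → ℬmax E d U → ¬ U (¬ᶠ a) → ℬmax E a U
      ℬmax-stronger a⊩d U∈ℬmax ¬a∉U =
        ℬmax-restrict (Coh-⊩ rm a⊩d) (λ x∈U x≼¬a → ¬a∉U (ℬmax-upward U∈ℬmax x∈U x≼¬a)) U∈ℬmax

      ℬmax-stronger-|∼ : a ⊩ d → a |∼ᴱ c → ℬmax E d U → U ⨾ a ⊢ c
      ℬmax-stronger-|∼ {a = a} {U = U} a⊩d a|∼c U∈ℬmax with em {U (¬ᶠ a)}
      ... | yes ¬a∈U = ⊢-explode (reflexive (inj₂ refl)) (reflexive (inj₁ ¬a∈U))
      ... | no ¬a∉U  = a|∼c U (ℬmax-stronger a⊩d U∈ℬmax ¬a∉U)

      orRule : OrRule C _|∼ᴱ_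
      orRule a|∼c b|∼c U U∈ℬmax =
        disjPremises (ℬmax-stronger-|∼ ⊩-∨ˡ a|∼c U∈ℬmax)
                     (ℬmax-stronger-|∼ ⊩-∨ʳ b|∼c U∈ℬmax)

      -- x ∧ (a ⇒ b) ∈ U lies below both ¬(a ∧ b) and a ⇒ b, hence below ¬a.
      ℬ-⨾⊢-Coh∧ : ℬ E a U → U ⨾ a ⊢ b → U ⊆ Coh E (a ∧ᶠ b)
      ℬ-⨾⊢-Coh∧ (closed , U⊆Coh) a⊢b x∈U x≼¬∧ =
        U⊆Coh (closed-∧ closed x∈U (closed-⇒ closed a⊢b))
              (≼-respʳ ¬∧∧⇒-⊣⊢ (rc (≼-left ⊩-∧ˡ x≼¬∧) (≼-left ⊩-∧ʳ ≼-refl)))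

      preferential : Preferential C _|∼ᴱ_
      preferential =
        cumulative-if zorn (λ _ → Coh-⊩ rm ⊩-∧ˡ)
                           (λ a|∼b U∈ℬmax → ℬ-⨾⊢-Coh∧ (proj₁ U∈ℬmax) (a|∼b _ U∈ℬmax)) ,
        orRule

mainTheorem10 : ExcludedMiddle (lsuc 0ℓ) → ZornLemma →
    ∀ {A : Set} (C : ConsRel A) (E : Entrenchment C) →
      NonmonotonicConsequence C (_|∼_ E)
      × (BoundedCut E → BoundedRightMonotonicity E → Cumulative C (_|∼_ E))
      × (BoundedCut E → RightMonotonicity E → StronglyCumulative C (_|∼_ E))
      × (Transitivity E → RightConjunction E → Preferential C (_|∼_ E))
mainTheorem10 em zorn C E =
  nonmonotonicConsequence , cumulative em₀ zorn , stronglyCumulative em₀ zorn , preferential em₀ zorn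
  where
    open Maxiconsistent E
    em₀ : ExcludedMiddle 0ℓ
    em₀ = lowerExcludedMiddle em
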